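{- Let $S$ be a string over $\Sigma$ in which each letter appears at most 3 times. If $S$ has a letter-duplicated subsequence containing every letter of $\Sigma$ that contains an LD-block of length 3, then $S$ has a letter-duplicated subsequence containing every letter of $\Sigma$ all of whose LD-blocks have length exactly 2.
   Context: A subsequence of $S$ is a letter-duplicated subsequence (LDS) if it has the form $x_1^{d_1}x_2^{d_2}\cdots x_k^{d_k}$ with $x_i\in\Sigma$, $x_j\neq x_{j+1}$ and $d_i\geq 2$ for all $i\in[k]$, $j\in[k-1]$; each $x_i^{d_i}$ is an LD-block (of length $d_i$). -}

module Defs where

open import Data.Nat using (ℕ; zero; suc; _≤_)
open import Data.Fin using (Fin)
open import Data.Fin.Properties using (_≟_)
open import Data.List using (List; []; _∷_; replicate; concatMap; map)
open import Data.List.Relation.Binary.Sublist.Propositional using (_⊆_)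
open import Data.List.Relation.Unary.Linked using (Linked)
open import Data.List.Relation.Unary.All using (All)
open import Data.List.Relation.Unary.Any using (Any)
open import Data.List.Membership.Propositional using (_∈_)
open import Data.Product using (_×_; _,_; proj₁; proj₂; Σ; ∃)
open import Relation.Binary.PropositionalEquality using (_≡_; _≢_)
open import Relation.Nullary using (yes; no)

occ : ∀ {n} → Fin n → List (Fin n) → ℕ
occ x [] = 0
occ x (y ∷ S) with x ≟ y
... | yes _ = suc (occ x S)
... | no  _ = occ x S

-- An LD-block x^d is represented as the pair (x , d).
Block : ℕ → Set
Block n = Fin n × ℕ

expand : ∀ {n} → List (Block n) → List (Fin n)
expand = concatMap (λ b → replicate (proj₂ b) (proj₁ b))

DiffLetters : ∀ {n} → Block n → Block n → Set
DiffLetters b c = proj₁ b ≢ proj₁ c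

IsLDForm : ∀ {n} → List (Block n) → Set
IsLDForm bs = All (λ b → 2 ≤ proj₂ b) bs × Linked DiffLetters bs

IsLDS : ∀ {n} → List (Block n) → List (Fin n) → Set
IsLDS bs S = IsLDForm bs × expand bs ⊆ S

ContainsAll : ∀ {n} → List (Block n) → Set
ContainsAll {n} bs = (x : Fin n) → x ∈ expand bs

{-# OPTIONS --safe #-}
module Submission where

-- Cutting every LD-block down to length 2 keeps the string a subsequence
-- of S (each block only loses letters), keeps the set of letters, and keeps
-- the LD-form, since the block letters are unchanged.

open import Defs
open import Data.Nat using (ℕ; _≤_; s≤s; z≤n)
open import Data.Nat.Properties using (≤-refl)
open import Data.Fin using (Fin)
open import Data.List using (List; []; _∷_; map; replicate)
open import Data.List.Relation.Unary.All as All using (All; []; _∷_)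
import Data.List.Relation.Unary.All.Properties as All
import Data.List.Relation.Unary.Linked.Properties as Linked
open import Data.List.Relation.Binary.Sublist.Propositional
  using (_⊆_; _∷_; minimum; ⊆-trans)
open import Data.List.Relation.Binary.Sublist.Propositional.Properties using (++⁺)
open import Data.List.Membership.Propositional using (_∈_)
open import Data.List.Membership.Propositional.Properties using (∈-++⁺ˡ; ∈-++⁺ʳ; ∈-++⁻)
open import Data.List.Relation.Unary.Any using (Any; here)
open import Data.Sum using (inj₁; inj₂)
open import Data.Product using (_×_; Σ; proj₁; proj₂; _,_)
open import Relation.Binary.PropositionalEquality using (_≡_; refl)

replicate-⊆ : ∀ {A : Set} {m n : ℕ} (x : A) → m ≤ n → replicate m x ⊆ replicate n x
replicate-⊆ {n = n} x z≤n = minimum (replicate n x)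
replicate-⊆ x (s≤s m≤n) = refl ∷ replicate-⊆ x m≤n

∈-replicate⁻ : ∀ {A : Set} {x y : A} (d : ℕ) → x ∈ replicate d y → x ≡ y
∈-replicate⁻ {y = y} d = All.lookup (All.replicate⁺ {P = _≡ y} d refl)

∈-replicate⁺ : ∀ {A : Set} {x : A} {m : ℕ} → 1 ≤ m → x ∈ replicate m x
∈-replicate⁺ (s≤s _) = here refl

resize : ∀ {n} → ℕ → Block n → Block n
resize k (x , _) = x , k

module _ {n : ℕ} (k : ℕ) where

  expand-resize-⊆ : (bs : List (Block n)) → All (λ b → k ≤ proj₂ b) bs →
                    expand (map (resize k) bs) ⊆ expand bs
  expand-resize-⊆ [] [] = minimum []
  expand-resize-⊆ ((x , d) ∷ bs) (k≤d ∷ ps) =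
    ++⁺ (replicate-⊆ x k≤d) (expand-resize-⊆ bs ps)

  resize-IsLDForm : 2 ≤ k → {bs : List (Block n)} → IsLDForm bs →
                    IsLDForm (map (resize k) bs)
  resize-IsLDForm 2≤k (_ , linked) = All.map⁺ (All.tabulate λ _ → 2≤k) , Linked.map⁺ linked

  ∈-expand-resize : 1 ≤ k → (bs : List (Block n)) {x : Fin n} →
                    x ∈ expand bs → x ∈ expand (map (resize k) bs)
  ∈-expand-resize 1≤k ((y , d) ∷ bs) x∈ with ∈-++⁻ (replicate d y) x∈
  ... | inj₁ x∈y^d rewrite ∈-replicate⁻ d x∈y^d = ∈-++⁺ˡ (∈-replicate⁺ 1≤k)
  ... | inj₂ x∈rest = ∈-++⁺ʳ (replicate k y) (∈-expand-resize 1≤k bs x∈rest)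

  resize-IsLDS : 2 ≤ k → {bs : List (Block n)} {S : List (Fin n)} →
                 All (λ b → k ≤ proj₂ b) bs → IsLDS bs S → IsLDS (map (resize k) bs) S
  resize-IsLDS 2≤k {bs} k≤ds (form , bs⊆S) =
    resize-IsLDForm 2≤k form , ⊆-trans (expand-resize-⊆ bs k≤ds) bs⊆S

  resize-ContainsAll : 1 ≤ k → (bs : List (Block n)) → ContainsAll bs →
                       ContainsAll (map (resize k) bs)
  resize-ContainsAll 1≤k bs all-letters x = ∈-expand-resize 1≤k bs (all-letters x)

  resize-lengths : (bs : List (Block n)) → All (λ b → proj₂ b ≡ k) (map (resize k) bs)
  resize-lengths _ = All.map⁺ (All.tabulate λ _ → refl)

lemma2 : (n : ℕ) (S : List (Fin n)) →
    ((x : Fin n) → occ x S ≤ 3) →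
    (Σ (List (Block n)) λ bs →
      IsLDS bs S × ContainsAll bs × Any (λ b → proj₂ b ≡ 3) bs) →
    Σ (List (Block n)) λ bs →
      IsLDS bs S × ContainsAll bs × All (λ b → proj₂ b ≡ 2) bs
lemma2 n S _ (bs , lds@((at-least-2 , _) , _) , all-letters , _) =
  map (resize 2) bs ,
  resize-IsLDS 2 ≤-refl at-least-2 lds ,
  resize-ContainsAll 2 (s≤s z≤n) bs all-letters ,
  resize-lengths 2 bs
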